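{- Let $w$ be a word over $\{a,b\}$. Then $m(\flat(w))\le m(w)$, and equality holds only if $\flat(w)=w$.
   Context: Let $A=\begin{pmatrix}1&1\\1&2\end{pmatrix}$, $B=\begin{pmatrix}2&1\\1&1\end{pmatrix}$, and for $w=x_1\cdots x_k\in\{a,b\}^\star$ let $M^w=M^{x_1}\cdots M^{x_k}$ with $M^a=A$, $M^b=B$ ($M^w=I$ for the empty word); $m(w)=\begin{pmatrix}1&0\end{pmatrix}M^w\begin{pmatrix}0\\1\end{pmatrix}$. A word is identified with the lattice path from $(0,0)$ with $a$ = step $(1,0)$, $b$ = step $(0,1)$. Write $[d]=\{0,1,\dots,d\}$. For a word $w$ with $d$ letters $a$ and $n$ letters $b$, let $\mathrm{Bel}(w)=\{(u,v)\in[d]\times\mathbb{N} : \exists\, p\ge v \text{ such that the path } w \text{ passes through } (u,p)\}$. A finite set $S\subseteq\mathbb{N}^2$ is packed if for some $d$ it is contained in $[d]\times\mathbb{N}$, contains $(0,0)$, is closed under $(u,v)\mapsto(u+1,v)$ for $u\le d-1$, and under $(u,v)\mapsto(u,v-1)$ for $v\ge1$. The map $w\mapsto \mathrm{Bel}(w)$ is a bijection from words onto packed sets, with inverse $\mathrm{Hull}(S)$, the path through the points $\{(x,y)\in S : (x-1,y+1)\notin S\}$. Define $\delta_w:[d]\times\mathbb{N}\to\mathbb{R}$ by $\delta_w(x,y)=(dy-nx)/d$ if $d\ge1$, and $\delta_w(0,y)=y$ if $d=0$. The flattening of $w$ is $\flat(w)=\mathrm{Hull}\big(\mathrm{Bel}(w)\cap\delta_w^{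 -1}(]-\infty,0])\big)$, i.e. the word whose below-set consists of the points of $\mathrm{Bel}(w)$ lying weakly below the line through $(0,0)$ and $(d,n)$. -}

module Defs where

open import Data.Nat using (ℕ; zero; suc; _+_; _*_; _∸_; _≤ᵇ_; _≡ᵇ_)
open import Data.Bool using (Bool; true; false; _∧_; if_then_else_)
open import Data.List using (List; []; _∷_; _++_; replicate)
open import Data.Bool.ListAction using (any)
open import Data.Product using (_×_; _,_)

data Letter : Set where
  a b : Letter

Word : Set
Word = List Letter

record Mat : Set where
  constructor mat
  field
    m11 m12 m21 m22 : ℕ

_⊗_ : Mat → Mat → Mat
mat p q r s ⊗ mat p' q' r' s' =
  mat (p * p' + q * r') (p * q' + q * s') (r * p' + s * r') (r * q' + s * s')

I₂ : Mat
I₂ = mat 1 0 0 1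

A B : Mat
A = mat 1 1 1 2
B = mat 2 1 1 1

M[_] : Letter → Mat
M[ a ] = A
M[ b ] = B

Mw : Word → Mat
Mw []       = I₂
Mw (x ∷ w)  = M[ x ] ⊗ Mw w

-- m(w) = (1 0) M^w (0 1)^T, the top-right entry
m : Word → ℕ
m w = Mat.m12 (Mw w)

#a #b : Word → ℕ
#a []      = 0
#a (a ∷ w) = suc (#a w)
#a (b ∷ w) = #a w
#b []      = 0
#b (a ∷ w) = #b w
#b (b ∷ w) = suc (#b w)

stepFrom : ℕ × ℕ → Letter → ℕ × ℕ
stepFrom (x , y) a = (suc x , y)
stepFrom (x , y) b = (x , suc y)

pathFrom : ℕ × ℕ → Word → List (ℕ × ℕ)
pathFrom p []      = p ∷ []
pathFrom p (l ∷ w) = p ∷ pathFrom (stepFrom p l) w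

points : Word → List (ℕ × ℕ)
points = pathFrom (0 , 0)

Subset2 : Set
Subset2 = ℕ → ℕ → Bool

Bel : Word → Subset2
Bel w u v = (u ≤ᵇ #a w) ∧ any (λ { (x , y) → (x ≡ᵇ u) ∧ (v ≤ᵇ y) }) (points w)

-- membership in δ_w^{-1}(]-∞,0]) (for (x,y) ∈ [d]×ℕ):
--   d ≥ 1 : (d y − n x)/d ≤ 0  ⇔  d*y ≤ n*x
--   d = 0 : δ_w(0,y) = y ≤ 0
δ≤0 : Word → Subset2
δ≤0 w x y with #a w
... | zero  = y ≤ᵇ 0
... | suc k = (suc k * y) ≤ᵇ (#b w * x)

_∩_ : Subset2 → Subset2 → Subset2
(S ∩ T) x y = S x y ∧ T x y

-- Hull(S) for a packed set S ⊆ [d]×[bnd]: the path through the points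
-- {(x,y) ∈ S : (x-1,y+1) ∉ S}.  For packed S these points are, in column x,
-- exactly the vertical segment from (x, h(x-1)) to (x, h(x)) (from (0,0) to (0,h 0)
-- when x = 0), where h x = max {y : (x,y) ∈ S}; so the path is
-- b^{h 0} a b^{h 1 ∸ h 0} a ⋯ a b^{h d ∸ h (d-1)}.
-- colTop S x k = max {y ≤ k : (x,y) ∈ S}  (0 if none)
colTop : Subset2 → ℕ → ℕ → ℕ
colTop S x zero    = 0
colTop S x (suc k) = if S x (suc k) then suc k else colTop S x k

hullUpTo : Subset2 → ℕ → ℕ → Word
hullUpTo S bnd zero    = replicate (colTop S 0 bnd) b
hullUpTo S bnd (suc x) =
  hullUpTo S bnd x ++ (a ∷ replicate (colTop S (suc x) bnd ∸ colTop S x bnd) b)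

Hull : (d bnd : ℕ) → Subset2 → Word
Hull d bnd S = hullUpTo S bnd d

-- flattening: ♭(w) = Hull(Bel(w) ∩ δ_w^{-1}(]-∞,0]));  Bel(w) ⊆ [d]×[n]
♭ : Word → Word
♭ w = Hull (#a w) (#b w) (Bel w ∩ δ≤0 w)

-- Let d = #a w, n = #b w and give a prefix s of w the height d·#b s − n·#a s, so that ♭ w
-- keeps exactly the points of the path weakly below the diagonal. If no prefix has positive
-- height, ♭ w = w. Otherwise the first prefix of maximal height ends in b and is followed by
-- an a; turning this ba into ab removes only a point strictly above the diagonal, so ♭ w does
-- not change, while m decreases by 2(αh − βg), where (α, β) is the first row of the matrix of
-- the part before and (g, h) the last column of the matrix of the part after. This minor is
-- positive because the path stays below the peak on both sides: peeling equal letters off both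
-- sides leaves it unchanged, and the first unequal pair must be b before, a after.
-- Induction on the number of inversions finishes the proof.

module Submission where

open import Defs
open import Data.Nat using (ℕ; zero; suc; _+_; _*_; _∸_; _≤_; _<_; z≤n; s≤s; _≤ᵇ_)
open import Data.Nat.Properties
open import Data.Nat.Tactic.RingSolver using (solve-∀)
open import Data.Product using (_×_; _,_; proj₁; proj₂; ∃-syntax)
open import Data.List using ([]; _∷_; _++_; [_]; _∷ʳ_; reverse; replicate)
open import Data.List.Properties
  using (++-assoc; ++-identityʳ; unfold-reverse; reverse-++; reverse-involutive; ∷-injective)
open import Data.List.Reverse using (reverseView; []; _∶_∶ʳ_)
open import Data.Integer using (ℤ; +_; -_; 0ℤ; +<+)
  renaming (_+_ to _+ℤ_; _≤_ to _≤ℤ_; _<_ to _<ℤ_; _<?_ to _<ℤ?_)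
import Data.Integer.Properties as ℤ
open import Data.Integer.Tactic.RingSolver renaming (solve-∀ to solveℤ-∀)
open import Data.Empty using (⊥-elim)
open import Data.Sum using (_⊎_; inj₁; inj₂)
open import Data.Bool using (Bool; true; false; T; _∧_; if_then_else_)
open import Data.Bool.Properties using (T-∧; ∧-assoc; ∧-zeroʳ)
open import Data.Unit using (tt)
open import Data.List.Membership.Propositional using (_∈_; find; lose)
open import Data.List.Relation.Unary.Any using (here; there)
open import Data.List.Relation.Unary.Any.Properties using (any⁺; any⁻)
open import Function.Bundles using (Equivalence)
open import Function.Base using (_∘_)
open import Relation.Nullary using (yes; no)
open import Induction.WellFounded using (Acc; acc)
open import Data.Nat.Induction using (<-wellFounded)
open import Relation.Binary.PropositionalEquality
  using (_≡_; _≢_; refl; sym; trans; cong; cong₂; subst; subst₂; module ≡-Reasoning)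

_·_ : ℕ × ℕ → Mat → ℕ × ℕ
(α , β) · mat p q r s = α * p + β * r , α * q + β * s

_∙_ : ℕ × ℕ → ℕ × ℕ → ℕ
(α , β) ∙ (g , h) = α * g + β * h

-- row r = (1 0) M^(reverse r): r is the part of a word before a position, read backwards.
row : Word → ℕ × ℕ
row []      = 1 , 0
row (x ∷ r) = row r · M[ x ]

col : Word → ℕ × ℕ
col v = Mat.m12 (Mw v) , Mat.m22 (Mw v)

·-∙-col : ∀ ρ x v → (ρ · M[ x ]) ∙ col v ≡ ρ ∙ col (x ∷ v)
·-∙-col (α , β) a v = byA α β (Mat.m12 (Mw v)) (Mat.m22 (Mw v))
  where
  byA : ∀ α β g h → (α * 1 + β * 1) * g + (α * 1 + β * 2) * h
                  ≡ α * (1 * g + 1 * h) + β * (1 * g + 2 * h)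
  byA = solve-∀
·-∙-col (α , β) b v = byB α β (Mat.m12 (Mw v)) (Mat.m22 (Mw v))
  where
  byB : ∀ α β g h → (α * 2 + β * 1) * g + (α * 1 + β * 1) * h
                  ≡ α * (2 * g + 1 * h) + β * (1 * g + 1 * h)
  byB = solve-∀

m-reverse-++ : ∀ r v → m (reverse r ++ v) ≡ row r ∙ col v
m-reverse-++ []      v = sym (trans (+-identityʳ _) (*-identityˡ _))
m-reverse-++ (x ∷ r) v = begin
  m (reverse (x ∷ r) ++ v)  ≡⟨ cong (λ u → m (u ++ v)) (unfold-reverse x r) ⟩
  m ((reverse r ++ [ x ]) ++ v) ≡⟨ cong m (++-assoc (reverse r) [ x ] v) ⟩
  m (reverse r ++ x ∷ v)    ≡⟨ m-reverse-++ r (x ∷ v) ⟩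
  row r ∙ col (x ∷ v)       ≡⟨ ·-∙-col (row r) x v ⟨
  row (x ∷ r) ∙ col v       ∎
  where open ≡-Reasoning

row-positive : ∀ r → 0 < proj₁ (row r)
row-positive []      = s≤s z≤n
row-positive (a ∷ r) = ≤-trans (row-positive r) (≤-trans (m≤m*n _ 1) (m≤m+n _ _))
row-positive (b ∷ r) = ≤-trans (row-positive r) (≤-trans (m≤m*n _ 2) (m≤m+n _ _))

col-positive : ∀ v → 0 < proj₂ (col v)
col-positive []      = s≤s z≤n
col-positive (a ∷ v) = ≤-trans (col-positive v) (≤-trans (m≤n*m _ 2) (m≤n+m _ (1 * Mat.m12 (Mw v))))
col-positive (b ∷ v) = ≤-trans (col-positive v) (≤-trans (m≤n*m _ 1) (m≤n+m _ (1 * Mat.m12 (Mw v))))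

DetPositive : ℕ × ℕ → ℕ × ℕ → Set
DetPositive (α , β) (g , h) = β * g < α * h

<-by-balance : ∀ {x y u v} → x + u ≡ y + v → v < u → x < y
<-by-balance {x} {y} {u} {v} eq v<u =
  +-cancelʳ-< v x y (subst (x + v <_) eq (+-monoʳ-< x v<u))

-- A and B are symmetric of determinant 1, so the minor is invariant under ρ ↦ ρ M, c ↦ M c.
detPositive-· : ∀ x ρ v → DetPositive ρ (col v) → DetPositive (ρ · M[ x ]) (col (x ∷ v))
detPositive-· a (α , β) v = <-by-balance (byA α β (Mat.m12 (Mw v)) (Mat.m22 (Mw v)))
  where
  byA : ∀ α β g h → (α * 1 + β * 2) * (1 * g + 1 * h) + α * h
                  ≡ (α * 1 + β * 1) * (1 * g + 2 * h) + β * g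
  byA = solve-∀
detPositive-· b (α , β) v = <-by-balance (byB α β (Mat.m12 (Mw v)) (Mat.m22 (Mw v)))
  where
  byB : ∀ α β g h → (α * 1 + β * 1) * (2 * g + 1 * h) + α * h
                  ≡ (α * 2 + β * 1) * (1 * g + 1 * h) + β * g
  byB = solve-∀

detPositive-ba : ∀ ρ v → 0 < proj₁ ρ → DetPositive (ρ · B) (col (a ∷ v))
detPositive-ba (α , β) v 0<α = subst (lhs <_) (sym (byBA α β g h))
  (m<m+n lhs (≤-trans (*-mono-< 0<α (col-positive v))
                      (≤-trans (m≤n*m _ 3) (m≤n+m _ (α * g + β * h)))))
  where
  g = Mat.m12 (Mw v)
  h = Mat.m22 (Mw v)
  lhs = (α * 1 + β * 1) * (1 * g + 1 * h)
  byBA : ∀ α β g h → (α * 2 + β * 1) * (1 * g + 2 * h)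
                   ≡ (α * 1 + β * 1) * (1 * g + 1 * h) + (α * g + β * h + 3 * (α * h))
  byBA = solve-∀

m-++ : ∀ u v → m (u ++ v) ≡ row (reverse u) ∙ col v
m-++ u v = trans (cong (λ u′ → m (u′ ++ v)) (sym (reverse-involutive u))) (m-reverse-++ (reverse u) v)

-- B A − A B = ( 0 2 ; −2 0 ), so swapping ab into ba adds 2 (αh − βg) to ρ ∙ col.
m-swap-< : ∀ u v → DetPositive (row (reverse u)) (col v) →
           m (u ++ a ∷ b ∷ v) < m (u ++ b ∷ a ∷ v)
m-swap-< u v det = subst₂ _<_ (sym (m-++ u (a ∷ b ∷ v))) (sym (m-++ u (b ∷ a ∷ v)))
  (swap (row (reverse u)) det)
  where
  swap : ∀ ρ → DetPositive ρ (col v) → ρ ∙ col (a ∷ b ∷ v) < ρ ∙ col (b ∷ a ∷ v)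
  swap (α , β) det = <-by-balance (byAB α β (Mat.m12 (Mw v)) (Mat.m22 (Mw v))) (*-monoʳ-< 2 det)
    where
    byAB : ∀ α β g h →
      α * (1 * (2 * g + 1 * h) + 1 * (1 * g + 1 * h))
        + β * (1 * (2 * g + 1 * h) + 2 * (1 * g + 1 * h)) + 2 * (α * h)
      ≡ α * (2 * (1 * g + 1 * h) + 1 * (1 * g + 2 * h))
        + β * (1 * (1 * g + 1 * h) + 1 * (1 * g + 2 * h)) + 2 * (β * g)
    byAB = solve-∀

m-positive : ∀ x w → 0 < m (x ∷ w)
m-positive a w = ≤-trans (col-positive w) (≤-trans (m≤n*m _ 1) (m≤n+m _ (1 * Mat.m12 (Mw w))))
m-positive b w = ≤-trans (col-positive w) (≤-trans (m≤n*m _ 1) (m≤n+m _ (2 * Mat.m12 (Mw w))))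

#a-++ : ∀ s t → #a (s ++ t) ≡ #a s + #a t
#a-++ []      t = refl
#a-++ (a ∷ s) t = cong suc (#a-++ s t)
#a-++ (b ∷ s) t = #a-++ s t

#b-++ : ∀ s t → #b (s ++ t) ≡ #b s + #b t
#b-++ []      t = refl
#b-++ (a ∷ s) t = #b-++ s t
#b-++ (b ∷ s) t = cong suc (#b-++ s t)

top : Word → ℕ → ℕ
top []      _       = 0
top (b ∷ w) x       = suc (top w x)
top (a ∷ w) zero    = 0
top (a ∷ w) (suc x) = top w x

top-≤-#b : ∀ w x → top w x ≤ #b w
top-≤-#b []      x       = z≤n
top-≤-#b (b ∷ w) x       = s≤s (top-≤-#b w x)
top-≤-#b (a ∷ w) zero    = z≤n
top-≤-#b (a ∷ w) (suc x) = top-≤-#b w x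

column-prefix : ∀ w x → x ≤ #a w →
                ∃[ w₁ ] ∃[ w₂ ] w ≡ w₁ ++ w₂ × #a w₁ ≡ x × #b w₁ ≡ top w x
column-prefix []      zero    _ = [] , [] , refl , refl , refl
column-prefix (b ∷ w) x       x≤ with column-prefix w x x≤
... | w₁ , w₂ , refl , refl , tops = b ∷ w₁ , w₂ , refl , refl , cong suc tops
column-prefix (a ∷ w) zero    _ = [] , a ∷ w , refl , refl , refl
column-prefix (a ∷ w) (suc x) (s≤s x≤) with column-prefix w x x≤
... | w₁ , w₂ , refl , refl , tops = a ∷ w₁ , w₂ , refl , refl , tops

top-swap-elsewhere : ∀ u v x → x ≢ #a u → top (u ++ a ∷ b ∷ v) x ≡ top (u ++ b ∷ a ∷ v) x
top-swap-elsewhere []      v zero    x≢ = ⊥-elim (x≢ refl)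
top-swap-elsewhere []      v (suc x) x≢ = refl
top-swap-elsewhere (b ∷ u) v x       x≢ = cong suc (top-swap-elsewhere u v x x≢)
top-swap-elsewhere (a ∷ u) v zero    x≢ = refl
top-swap-elsewhere (a ∷ u) v (suc x) x≢ = top-swap-elsewhere u v x (x≢ ∘ cong suc)

top-ab : ∀ u v → top (u ++ a ∷ b ∷ v) (#a u) ≡ #b u
top-ab []      v = refl
top-ab (b ∷ u) v = cong suc (top-ab u v)
top-ab (a ∷ u) v = top-ab u v

top-ba : ∀ u v → top (u ++ b ∷ a ∷ v) (#a u) ≡ suc (#b u)
top-ba []      v = refl
top-ba (b ∷ u) v = cong suc (top-ba u v)
top-ba (a ∷ u) v = top-ba u v

inversions : Word → ℕ
inversions []      = 0
inversions (a ∷ w) = inversions w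
inversions (b ∷ w) = #a w + inversions w

#a-swap : ∀ u v → #a (u ++ a ∷ b ∷ v) ≡ #a (u ++ b ∷ a ∷ v)
#a-swap u v = trans (#a-++ u (a ∷ b ∷ v)) (sym (#a-++ u (b ∷ a ∷ v)))

#b-swap : ∀ u v → #b (u ++ a ∷ b ∷ v) ≡ #b (u ++ b ∷ a ∷ v)
#b-swap u v = trans (#b-++ u (a ∷ b ∷ v)) (sym (#b-++ u (b ∷ a ∷ v)))

inversions-swap : ∀ u v → inversions (u ++ a ∷ b ∷ v) < inversions (u ++ b ∷ a ∷ v)
inversions-swap []      v = ≤-refl
inversions-swap (a ∷ u) v = inversions-swap u v
inversions-swap (b ∷ u) v rewrite #a-swap u v = +-monoʳ-< (#a (u ++ b ∷ a ∷ v)) (inversions-swap u v)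

ℤ-+-cancelˡ-≤ : ∀ i {j k} → i +ℤ j ≤ℤ i +ℤ k → j ≤ℤ k
ℤ-+-cancelˡ-≤ i {j} {k} le = subst₂ _≤ℤ_ (cancel i j) (cancel i k) (ℤ.+-monoʳ-≤ (- i) le)
  where
  cancel : ∀ i j → - i +ℤ (i +ℤ j) ≡ j
  cancel = solveℤ-∀

module Heights (d n : ℕ) where

  weight : Letter → ℤ
  weight a = - + n
  weight b = + d

  height : Word → ℤ
  height []      = 0ℤ
  height (x ∷ w) = weight x +ℤ height w

  height-++ : ∀ s t → height (s ++ t) ≡ height s +ℤ height t
  height-++ []      t = sym (ℤ.+-identityˡ _)
  height-++ (x ∷ s) t = trans (cong (weight x +ℤ_) (height-++ s t)) (sym (ℤ.+-assoc (weight x) _ _))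

  height-counts : ∀ s → height s +ℤ + (n * #a s) ≡ + (d * #b s)
  height-counts []      rewrite *-zeroʳ n | *-zeroʳ d = refl
  height-counts (a ∷ s) = begin
    (- + n +ℤ height s) +ℤ + (n * suc (#a s))      ≡⟨ cong (λ k → (- + n +ℤ height s) +ℤ + k)
                                                             (*-suc n (#a s)) ⟩
    (- + n +ℤ height s) +ℤ + (n + n * #a s)        ≡⟨ cong ((- + n +ℤ height s) +ℤ_) (ℤ.pos-+ n _) ⟩
    (- + n +ℤ height s) +ℤ (+ n +ℤ + (n * #a s))   ≡⟨ cancel (+ n) (height s) _ ⟩
    height s +ℤ + (n * #a s)                       ≡⟨ height-counts s ⟩
    + (d * #b s)                                   ∎
    where
    open ≡-Reasoning
    cancel : ∀ i j k → (- i +ℤ j) +ℤ (i +ℤ k) ≡ j +ℤ k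
    cancel = solveℤ-∀
  height-counts (b ∷ s) = begin
    (+ d +ℤ height s) +ℤ + (n * #a s)   ≡⟨ ℤ.+-assoc (+ d) (height s) _ ⟩
    + d +ℤ (height s +ℤ + (n * #a s))   ≡⟨ cong (+ d +ℤ_) (height-counts s) ⟩
    + d +ℤ + (d * #b s)                 ≡⟨ ℤ.pos-+ d _ ⟨
    + (d + d * #b s)                    ≡⟨ cong +_ (*-suc d (#b s)) ⟨
    + (d * suc (#b s))                  ∎
    where open ≡-Reasoning

  height≤0⇒ : ∀ s → height s ≤ℤ 0ℤ → d * #b s ≤ n * #a s
  height≤0⇒ s le = ℤ.drop‿+≤+
    (subst₂ _≤ℤ_ (height-counts s) (ℤ.+-identityˡ _) (ℤ.+-monoˡ-≤ (+ (n * #a s)) le))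

  0<height⇒ : ∀ s → 0ℤ <ℤ height s → n * #a s < d * #b s
  0<height⇒ s lt = ℤ.drop‿+<+
    (subst₂ _<ℤ_ (ℤ.+-identityˡ _) (height-counts s) (ℤ.+-monoˡ-< (+ (n * #a s)) lt))

  height-balanced : ∀ w → #a w ≡ d → #b w ≡ n → height w ≡ 0ℤ
  height-balanced w refl refl = begin
    height w                ≡⟨ shift (height w) X ⟩
    (height w +ℤ X) +ℤ - X  ≡⟨ cong (_+ℤ - X) (trans (height-counts w) (cong +_ (*-comm d n))) ⟩
    X +ℤ - X                ≡⟨ ℤ.+-inverseʳ X ⟩
    0ℤ                      ∎
    where
    open ≡-Reasoning
    X = + (n * d)
    shift : ∀ i j → i ≡ (i +ℤ j) +ℤ - j
    shift = solveℤ-∀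

  AllHeights : (ℤ → Set) → ℤ → Word → Set
  AllHeights P c []      = P c
  AllHeights P c (x ∷ w) = P c × AllHeights P (c +ℤ weight x) w

  allHeights-start : ∀ {P c} w → AllHeights P c w → P c
  allHeights-start []      p       = p
  allHeights-start (_ ∷ _) (p , _) = p

  allHeights-prefixes : ∀ {P} c w → (∀ s t → w ≡ s ++ t → P (c +ℤ height s)) → AllHeights P c w
  allHeights-prefixes {P} c []      h = subst P (ℤ.+-identityʳ c) (h [] [] refl)
  allHeights-prefixes {P} c (x ∷ w) h =
    subst P (ℤ.+-identityʳ c) (h [] (x ∷ w) refl) ,
    allHeights-prefixes (c +ℤ weight x) w
      (λ s t eq → subst P (sym (ℤ.+-assoc c (weight x) (height s))) (h (x ∷ s) t (cong (x ∷_) eq)))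

  -- For a site u·ba·v, AllHeights BelowPeak 0ℤ (reverse u) says that every point of u lies
  -- strictly below the end of u·b, and AllHeights AtMostPeak 0ℤ v that no point after it is higher.
  BelowPeak AtMostPeak : ℤ → Set
  BelowPeak  h = 0ℤ <ℤ h +ℤ + d
  AtMostPeak h = - + n +ℤ h ≤ℤ 0ℤ

  detPositive : ∀ c r v → AllHeights BelowPeak c r → AllHeights AtMostPeak c v →
                DetPositive (row r) (col v)
  detPositive c []      v  _ _ = subst (0 <_) (sym (*-identityˡ _)) (col-positive v)
  detPositive c (x ∷ r) [] _ _ =
    subst₂ _<_ (sym (*-zeroʳ (proj₂ (row (x ∷ r))))) (sym (*-identityʳ _)) (row-positive (x ∷ r))
  detPositive c (a ∷ r) (a ∷ v) (_ , below) (_ , atMost) =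
    detPositive-· a (row r) v (detPositive (c +ℤ weight a) r v below atMost)
  detPositive c (b ∷ r) (b ∷ v) (_ , below) (_ , atMost) =
    detPositive-· b (row r) v (detPositive (c +ℤ weight b) r v below atMost)
  detPositive c (b ∷ r) (a ∷ v) _ _ = detPositive-ba (row r) v (row-positive r)
  detPositive c (a ∷ r) (b ∷ v) (_ , below) (_ , atMost) =
    ⊥-elim (ℤ.<-irrefl refl (ℤ.<-≤-trans
      (subst (0ℤ <ℤ_) (shuffle c (+ n) (+ d)) (allHeights-start r below))
      (allHeights-start v atMost)))
    where
    shuffle : ∀ i j k → (i +ℤ - j) +ℤ k ≡ - j +ℤ (i +ℤ k)
    shuffle = solveℤ-∀

  record FirstMaximum (w : Word) : Set where
    constructor firstMax
    field
      prefix suffix : Word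
      split   : w ≡ prefix ++ suffix
      maximal : ∀ s t → w ≡ s ++ t → height s ≤ℤ height prefix
      -- no shorter prefix is as high:
      first   : ∀ s t x → prefix ≡ s ++ t ∷ʳ x → 0ℤ <ℤ height (t ∷ʳ x)

  firstMaximum : ∀ w → FirstMaximum w
  firstMaximum [] = firstMax [] [] refl maximal first
    where
    maximal : ∀ s t → [] ≡ s ++ t → height s ≤ℤ 0ℤ
    maximal [] [] refl = ℤ.≤-refl
    first : ∀ s t x → [] ≡ s ++ t ∷ʳ x → 0ℤ <ℤ height (t ∷ʳ x)
    first []      []      _ ()
    first []      (_ ∷ _) _ ()
    first (_ ∷ _) _       _ ()
  firstMaximum (y ∷ w) with firstMaximum w
  ... | firstMax p q refl maximal first with 0ℤ <ℤ? height (y ∷ p)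
  ...   | yes rises = firstMax (y ∷ p) q refl maximal′ first′
    where
    maximal′ : ∀ s t → y ∷ p ++ q ≡ s ++ t → height s ≤ℤ height (y ∷ p)
    maximal′ []      _ _    = ℤ.<⇒≤ rises
    maximal′ (_ ∷ s) t eq with ∷-injective eq
    ... | refl , eq′ = ℤ.+-monoʳ-≤ (weight y) (maximal s t eq′)
    first′ : ∀ s t x → y ∷ p ≡ s ++ t ∷ʳ x → 0ℤ <ℤ height (t ∷ʳ x)
    first′ []      t x eq   = subst (λ u → 0ℤ <ℤ height u) eq rises
    first′ (_ ∷ s) t x refl = first s t x refl
  ...   | no ¬rises = firstMax [] (y ∷ p ++ q) refl maximal′ first′
    where
    maximal′ : ∀ s t → y ∷ p ++ q ≡ s ++ t → height s ≤ℤ 0ℤ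
    maximal′ []      _ _    = ℤ.≤-refl
    maximal′ (_ ∷ s) t eq with ∷-injective eq
    ... | refl , eq′ = ℤ.≤-trans (ℤ.+-monoʳ-≤ (weight y) (maximal s t eq′)) (ℤ.≮⇒≥ ¬rises)
    first′ : ∀ s t x → [] ≡ s ++ t ∷ʳ x → 0ℤ <ℤ height (t ∷ʳ x)
    first′ []      []      _ ()
    first′ []      (_ ∷ _) _ ()
    first′ (_ ∷ _) _       _ ()

  nonpositive-after-maximum : ∀ p q → (∀ s t → p ++ q ≡ s ++ t → height s ≤ℤ height p) →
                              ∀ s t → q ≡ s ++ t → height s ≤ℤ 0ℤ
  nonpositive-after-maximum p _ maximal s t refl =
    ℤ-+-cancelˡ-≤ (height p) (subst₂ _≤ℤ_ (height-++ p s) (sym (ℤ.+-identityʳ _))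
      (maximal (p ++ s) t (sym (++-assoc p s t))))

  height-reverse : ∀ s → height (reverse s) ≡ height s
  height-reverse []      = refl
  height-reverse (x ∷ s) = begin
    height (reverse (x ∷ s))        ≡⟨ cong height (unfold-reverse x s) ⟩
    height (reverse s ∷ʳ x)         ≡⟨ height-++ (reverse s) [ x ] ⟩
    height (reverse s) +ℤ height [ x ] ≡⟨ cong₂ _+ℤ_ (height-reverse s) (ℤ.+-identityʳ _) ⟩
    height s +ℤ weight x            ≡⟨ ℤ.+-comm (height s) (weight x) ⟩
    height (x ∷ s)                  ∎
    where open ≡-Reasoning

  record SwapSite (w : Word) : Set where
    constructor swapSite
    field
      before after : Word
      split   : w ≡ before ++ b ∷ a ∷ after
      rising  : AllHeights BelowPeak 0ℤ (reverse before)
      falling : AllHeights AtMostPeak 0ℤ after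
      peak    : 0ℤ <ℤ height (before ∷ʳ b)

  swapSite-at-peak : ∀ {w} → 0 < d → height w ≡ 0ℤ → (fm : FirstMaximum w) →
                     0ℤ <ℤ height (FirstMaximum.prefix fm) → SwapSite w
  swapSite-at-peak 0<d balanced (firstMax p q refl maximal first) peak
    with reverseView p
  ... | [] = ⊥-elim (ℤ.<-irrefl refl peak)
  ... | u ∶ _ ∶ʳ a = ⊥-elim (ℤ.<-irrefl refl
          (ℤ.<-≤-trans (first u [] a refl)
                       (subst (_≤ℤ 0ℤ) (sym (ℤ.+-identityʳ _)) (ℤ.neg-≤-pos {n} {0}))))
  ... | u ∶ _ ∶ʳ b with q
  ...   | [] = ⊥-elim (ℤ.<-irrefl
          (sym (trans (cong height (sym (++-identityʳ (u ∷ʳ b)))) balanced)) peak)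
  ...   | b ∷ v = ⊥-elim (ℤ.<-irrefl refl (ℤ.<-≤-trans (+<+ 0<d)
          (subst (_≤ℤ 0ℤ) (ℤ.+-identityʳ _)
                 (nonpositive-after-maximum (u ∷ʳ b) (b ∷ v) maximal [ b ] v refl))))
  ...   | a ∷ v = swapSite u v (++-assoc u [ b ] (a ∷ v)) rising falling peak
    where
    rising : AllHeights BelowPeak 0ℤ (reverse u)
    rising = allHeights-prefixes 0ℤ (reverse u) λ s t eq →
      subst (0ℤ <ℤ_) (peak-height s) (first (reverse t) (reverse s) b (split-before s t eq))
      where
      split-before : ∀ s t → reverse u ≡ s ++ t → u ∷ʳ b ≡ reverse t ++ reverse s ∷ʳ b
      split-before s t eq = begin
        u ∷ʳ b                         ≡⟨ cong (_∷ʳ b) (reverse-involutive u) ⟨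
        reverse (reverse u) ∷ʳ b       ≡⟨ cong (λ r → reverse r ∷ʳ b) eq ⟩
        reverse (s ++ t) ∷ʳ b          ≡⟨ cong (_∷ʳ b) (reverse-++ s t) ⟩
        (reverse t ++ reverse s) ∷ʳ b  ≡⟨ ++-assoc (reverse t) (reverse s) [ b ] ⟩
        reverse t ++ reverse s ∷ʳ b    ∎
        where open ≡-Reasoning
      peak-height : ∀ s → height (reverse s ∷ʳ b) ≡ (0ℤ +ℤ height s) +ℤ + d
      peak-height s = begin
        height (reverse s ∷ʳ b)             ≡⟨ height-++ (reverse s) [ b ] ⟩
        height (reverse s) +ℤ (+ d +ℤ 0ℤ)   ≡⟨ cong₂ _+ℤ_ (height-reverse s) (ℤ.+-identityʳ _) ⟩
        height s +ℤ + d                     ≡⟨ cong (_+ℤ + d) (ℤ.+-identityˡ (height s)) ⟨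
        (0ℤ +ℤ height s) +ℤ + d             ∎
        where open ≡-Reasoning
    falling : AllHeights AtMostPeak 0ℤ v
    falling = allHeights-prefixes 0ℤ v λ s t eq →
      subst (λ h → - + n +ℤ h ≤ℤ 0ℤ) (sym (ℤ.+-identityˡ _))
        (nonpositive-after-maximum (u ∷ʳ b) (a ∷ v) maximal (a ∷ s) t (cong (a ∷_) eq))

  swapSite-or-below : 0 < d → ∀ w → height w ≡ 0ℤ →
                      SwapSite w ⊎ (∀ s t → w ≡ s ++ t → height s ≤ℤ 0ℤ)
  swapSite-or-below 0<d w balanced with firstMaximum w
  ... | fm@(firstMax p _ _ maximal _) with 0ℤ <ℤ? height p
  ...   | yes peak = inj₁ (swapSite-at-peak 0<d balanced fm peak)
  ...   | no ¬peak = inj₂ λ s t eq → ℤ.≤-trans (maximal s t eq) (ℤ.≮⇒≥ ¬peak)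

  columns-below : ∀ w → (∀ s t → w ≡ s ++ t → height s ≤ℤ 0ℤ) →
                  ∀ x → x ≤ #a w → d * top w x ≤ n * x
  columns-below w below x x≤ with column-prefix w x x≤
  ... | w₁ , w₂ , split , refl , tops =
    subst (λ h → d * h ≤ n * #a w₁) tops (height≤0⇒ w₁ (below w₁ w₂ split))

  above-diagonal : ∀ u → 0ℤ <ℤ height (u ∷ʳ b) → n * #a u < d * suc (#b u)
  above-diagonal u peak = subst₂ (λ i j → n * i < d * j)
    (trans (#a-++ u [ b ]) (+-identityʳ _)) (trans (#b-++ u [ b ]) (+-comm (#b u) 1))
    (0<height⇒ (u ∷ʳ b) peak)

T-extensional : ∀ {p q} → (T p → T q) → (T q → T p) → p ≡ q
T-extensional {false} {false} _ _ = refl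
T-extensional {false} {true}  _ g = ⊥-elim (g tt)
T-extensional {true}  {false} f _ = ⊥-elim (f tt)
T-extensional {true}  {true}  _ _ = refl

≤ᵇ-true : ∀ {m n} → m ≤ n → (m ≤ᵇ n) ≡ true
≤ᵇ-true m≤n = T-extensional (λ _ → tt) (λ _ → ≤⇒≤ᵇ m≤n)

≤ᵇ-false : ∀ {m n} → n < m → (m ≤ᵇ n) ≡ false
≤ᵇ-false {m} {n} n<m = T-extensional (λ t → <⇒≱ n<m (≤ᵇ⇒≤ m n t)) λ ()

top-on-path : ∀ w x₀ y₀ k → k ≤ #a w → (x₀ + k , y₀ + top w k) ∈ pathFrom (x₀ , y₀) w
top-on-path []      x₀ y₀ zero    _ rewrite +-identityʳ x₀ | +-identityʳ y₀ = here refl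
top-on-path (b ∷ w) x₀ y₀ k       k≤ rewrite +-suc y₀ (top w k) = there (top-on-path w x₀ (suc y₀) k k≤)
top-on-path (a ∷ w) x₀ y₀ zero    _ rewrite +-identityʳ x₀ | +-identityʳ y₀ = here refl
top-on-path (a ∷ w) x₀ y₀ (suc k) (s≤s k≤) rewrite +-suc x₀ k = there (top-on-path w (suc x₀) y₀ k k≤)

below-top : ∀ w x₀ y₀ {p q} → (p , q) ∈ pathFrom (x₀ , y₀) w → ∃[ k ] p ≡ x₀ + k × q ≤ y₀ + top w k
below-top []      x₀ y₀ (here refl) = 0 , sym (+-identityʳ x₀) , m≤m+n y₀ _
below-top (_ ∷ _) x₀ y₀ (here refl) = 0 , sym (+-identityʳ x₀) , m≤m+n y₀ _
below-top (b ∷ w) x₀ y₀ {q = q} (there p∈) with below-top w x₀ (suc y₀) p∈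
... | k , refl , q≤ = k , refl , subst (q ≤_) (sym (+-suc y₀ (top w k))) q≤
below-top (a ∷ w) x₀ y₀ (there p∈) with below-top w (suc x₀) y₀ p∈
... | k , refl , q≤ = suc k , sym (+-suc x₀ k) , q≤

Bel-top : ∀ w x y → Bel w x y ≡ (x ≤ᵇ #a w) ∧ (y ≤ᵇ top w x)
Bel-top w x y = T-extensional to from
  where
  to : T (Bel w x y) → T ((x ≤ᵇ #a w) ∧ (y ≤ᵇ top w x))
  to t with Equivalence.to T-∧ t
  ... | x≤ , reached with find (any⁻ _ (points w) reached)
  ...   | (p , q) , p∈ , hit with Equivalence.to T-∧ hit | below-top w 0 0 p∈
  ...     | p≡x , y≤q | k , refl , q≤ rewrite ≡ᵇ⇒≡ k x p≡x =
    Equivalence.from T-∧ (x≤ , ≤⇒≤ᵇ (≤-trans (≤ᵇ⇒≤ y q y≤q) q≤))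
  from : T ((x ≤ᵇ #a w) ∧ (y ≤ᵇ top w x)) → T (Bel w x y)
  from t with Equivalence.to T-∧ t
  ... | x≤ , y≤ = Equivalence.from T-∧ (x≤ , any⁺ _
          (lose (top-on-path w 0 0 x (≤ᵇ⇒≤ x _ x≤)) (Equivalence.from T-∧ (≡⇒≡ᵇ x x refl , y≤))))

hullOfTops : (ℕ → ℕ) → ℕ → Word
hullOfTops t zero    = replicate (t 0) b
hullOfTops t (suc x) = hullOfTops t x ++ a ∷ replicate (t (suc x) ∸ t x) b

hullOfTops-b∷ : ∀ w x → hullOfTops (top (b ∷ w)) x ≡ b ∷ hullOfTops (top w) x
hullOfTops-b∷ w zero    = refl
hullOfTops-b∷ w (suc x) = cong (_++ a ∷ replicate (top w (suc x) ∸ top w x) b) (hullOfTops-b∷ w x)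

hullOfTops-a∷ : ∀ w x → hullOfTops (top (a ∷ w)) (suc x) ≡ a ∷ hullOfTops (top w) x
hullOfTops-a∷ w zero    = refl
hullOfTops-a∷ w (suc x) = cong (_++ a ∷ replicate (top w (suc x) ∸ top w x) b) (hullOfTops-a∷ w x)

hullOfTops-top : ∀ w → hullOfTops (top w) (#a w) ≡ w
hullOfTops-top []      = refl
hullOfTops-top (b ∷ w) = trans (hullOfTops-b∷ w (#a w)) (cong (b ∷_) (hullOfTops-top w))
hullOfTops-top (a ∷ w) = trans (hullOfTops-a∷ w (#a w)) (cong (a ∷_) (hullOfTops-top w))

hullUpTo-tops : ∀ S bnd t x → (∀ k → k ≤ x → colTop S k bnd ≡ t k) → hullUpTo S bnd x ≡ hullOfTops t x
hullUpTo-tops S bnd t zero    tops = cong (λ h → replicate h b) (tops 0 z≤n)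
hullUpTo-tops S bnd t (suc x) tops =
  cong₂ (λ u h → u ++ a ∷ replicate h b)
    (hullUpTo-tops S bnd t x (λ k k≤x → tops k (m≤n⇒m≤1+n k≤x)))
    (cong₂ _∸_ (tops (suc x) ≤-refl) (tops x (n≤1+n x)))

colTop-cong : ∀ S S′ x k → (∀ y → S x y ≡ S′ x y) → colTop S x k ≡ colTop S′ x k
colTop-cong S S′ x zero    eq = refl
colTop-cong S S′ x (suc k) eq rewrite eq (suc k) =
  cong (if S′ x (suc k) then suc k else_) (colTop-cong S S′ x k eq)

hullUpTo-cong : ∀ S S′ bnd x → (∀ x y → S x y ≡ S′ x y) → hullUpTo S bnd x ≡ hullUpTo S′ bnd x
hullUpTo-cong S S′ bnd x eq = trans
  (hullUpTo-tops S bnd (λ k → colTop S′ k bnd) x (λ k _ → colTop-cong S S′ k bnd (eq k)))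
  (sym (hullUpTo-tops S′ bnd (λ k → colTop S′ k bnd) x (λ _ _ → refl)))

colTop-downset : ∀ S x h k → (∀ y → S x y ≡ (y ≤ᵇ h)) → h ≤ k → colTop S x k ≡ h
colTop-downset S x h zero    column z≤n = refl
colTop-downset S x h (suc k) column h≤ rewrite column (suc k) with h ≟ suc k
... | yes refl rewrite ≤ᵇ-true (≤-refl {suc k}) = refl
... | no h≢ rewrite ≤ᵇ-false (≤∧≢⇒< h≤ h≢) = colTop-downset S x h k column (m<1+n⇒m≤n (≤∧≢⇒< h≤ h≢))

belowLine : ℕ → ℕ → ℕ → ℕ → Bool
belowLine zero    n x y = y ≤ᵇ 0
belowLine (suc k) n x y = suc k * y ≤ᵇ n * x

δ≤0-belowLine : ∀ w x y → δ≤0 w x y ≡ belowLine (#a w) (#b w) x y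
δ≤0-belowLine w x y with #a w
... | zero  = refl
... | suc k = refl

FlatSet : ℕ → ℕ → (ℕ → ℕ) → Subset2
FlatSet d n t x y = (x ≤ᵇ d) ∧ (y ≤ᵇ t x) ∧ belowLine d n x y

♭-top : ∀ w → ♭ w ≡ Hull (#a w) (#b w) (FlatSet (#a w) (#b w) (top w))
♭-top w = hullUpTo-cong _ _ (#b w) (#a w) λ x y →
  trans (cong₂ _∧_ (Bel-top w x y) (δ≤0-belowLine w x y)) (∧-assoc (x ≤ᵇ #a w) _ _)

♭-counts : ∀ w d n → #a w ≡ d → #b w ≡ n → ♭ w ≡ Hull d n (FlatSet d n (top w))
♭-counts w d n refl refl = ♭-top w

♭-empty : ∀ w → #a w ≡ 0 → ♭ w ≡ []
♭-empty w d≡0 = trans (♭-counts w 0 (#b w) d≡0 refl)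
  (cong (λ h → replicate h b) (colTop-downset _ 0 0 (#b w) column z≤n))
  where
  column : ∀ y → (y ≤ᵇ top w 0) ∧ (y ≤ᵇ 0) ≡ (y ≤ᵇ 0)
  column y = T-extensional (λ t → proj₂ (Equivalence.to T-∧ t))
    (λ t → Equivalence.from T-∧ (≤⇒≤ᵇ (≤-trans (≤ᵇ⇒≤ y 0 t) z≤n) , t))

♭-fixed : ∀ w k → #a w ≡ suc k → (∀ x → x ≤ suc k → suc k * top w x ≤ #b w * x) → ♭ w ≡ w
♭-fixed w k d≡ below = begin
  ♭ w                                             ≡⟨ ♭-counts w (suc k) (#b w) d≡ refl ⟩
  Hull (suc k) (#b w) (FlatSet (suc k) (#b w) (top w)) ≡⟨ hullUpTo-tops _ (#b w) (top w) (suc k) tops ⟩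
  hullOfTops (top w) (suc k)                      ≡⟨ cong (hullOfTops (top w)) d≡ ⟨
  hullOfTops (top w) (#a w)                       ≡⟨ hullOfTops-top w ⟩
  w                                               ∎
  where
  open ≡-Reasoning
  tops : ∀ x → x ≤ suc k → colTop (FlatSet (suc k) (#b w) (top w)) x (#b w) ≡ top w x
  tops x x≤ = colTop-downset _ x (top w x) (#b w) column (top-≤-#b w x)
    where
    column : ∀ y → FlatSet (suc k) (#b w) (top w) x y ≡ (y ≤ᵇ top w x)
    column y = T-extensional
      (λ t → proj₁ (Equivalence.to T-∧ (proj₂ (Equivalence.to (T-∧ {x ≤ᵇ suc k}) t))))
      (λ t → Equivalence.from T-∧ (≤⇒≤ᵇ x≤ , Equivalence.from T-∧
        (t , ≤⇒≤ᵇ (≤-trans (*-monoʳ-≤ (suc k) (≤ᵇ⇒≤ y _ t)) (below x x≤)))))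

drop-top-point : ∀ h (L : ℕ → Bool) → L (suc h) ≡ false → ∀ y → (y ≤ᵇ h) ∧ L y ≡ (y ≤ᵇ suc h) ∧ L y
drop-top-point h L L-false y with y ≟ suc h
... | yes refl rewrite L-false = trans (∧-zeroʳ _) (sym (∧-zeroʳ _))
... | no y≢ = cong (_∧ L y) (T-extensional
  (λ t → ≤⇒≤ᵇ (m≤n⇒m≤1+n (≤ᵇ⇒≤ y h t)))
  (λ t → ≤⇒≤ᵇ (m<1+n⇒m≤n (≤∧≢⇒< (≤ᵇ⇒≤ y (suc h) t) y≢))))

-- Swapping ba into ab only removes the point (#a u, #b u + 1), which lies strictly above the diagonal.
♭-swap : ∀ u v k → #a (u ++ b ∷ a ∷ v) ≡ suc k →
         #b (u ++ b ∷ a ∷ v) * #a u < suc k * suc (#b u) →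
         ♭ (u ++ a ∷ b ∷ v) ≡ ♭ (u ++ b ∷ a ∷ v)
♭-swap u v k d≡ above = begin
  ♭ (u ++ a ∷ b ∷ v)                  ≡⟨ ♭-counts (u ++ a ∷ b ∷ v) (suc k) n
                                               (trans (#a-swap u v) d≡) (#b-swap u v) ⟩
  Hull (suc k) n (FlatSet (suc k) n (top (u ++ a ∷ b ∷ v)))
                                      ≡⟨ hullUpTo-cong _ _ n (suc k) same-set ⟩
  Hull (suc k) n (FlatSet (suc k) n (top (u ++ b ∷ a ∷ v)))
                                      ≡⟨ ♭-counts (u ++ b ∷ a ∷ v) (suc k) n d≡ refl ⟨
  ♭ (u ++ b ∷ a ∷ v)                  ∎
  where
  open ≡-Reasoning
  n = #b (u ++ b ∷ a ∷ v)
  same-set : ∀ x y → FlatSet (suc k) n (top (u ++ a ∷ b ∷ v)) x y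
                   ≡ FlatSet (suc k) n (top (u ++ b ∷ a ∷ v)) x y
  same-set x y with x ≟ #a u
  ... | no x≢ rewrite top-swap-elsewhere u v x x≢ = refl
  ... | yes refl rewrite top-ab u v | top-ba u v =
    cong ((#a u ≤ᵇ suc k) ∧_) (drop-top-point (#b u) (belowLine (suc k) n (#a u)) (≤ᵇ-false above) y)

♭-decreases-without-a : ∀ w → #a w ≡ 0 → ♭ w ≡ w ⊎ m (♭ w) < m w
♭-decreases-without-a []      _   = inj₁ refl
♭-decreases-without-a (x ∷ w) d≡0 =
  inj₂ (subst (λ u → m u < m (x ∷ w)) (sym (♭-empty (x ∷ w) d≡0)) (m-positive x w))

module _ (w : Word) (k : ℕ) (d≡ : #a w ≡ suc k) where
  open Heights (suc k) (#b w)

  ♭-decreases-step : (∀ w′ → inversions w′ < inversions w → ♭ w′ ≡ w′ ⊎ m (♭ w′) < m w′) →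
                     ♭ w ≡ w ⊎ m (♭ w) < m w
  ♭-decreases-step smaller with swapSite-or-below (s≤s z≤n) w (height-balanced w d≡ refl)
  ... | inj₂ below =
    inj₁ (♭-fixed w k d≡ λ x x≤ → columns-below w below x (subst (x ≤_) (sym d≡) x≤))
  ... | inj₁ (swapSite u v refl rising falling peak) = inj₂ (begin-strict
    m (♭ (u ++ b ∷ a ∷ v))  ≡⟨ cong m (♭-swap u v k d≡ (above-diagonal u peak)) ⟨
    m (♭ (u ++ a ∷ b ∷ v))  ≤⟨ weaken (smaller (u ++ a ∷ b ∷ v) (inversions-swap u v)) ⟩
    m (u ++ a ∷ b ∷ v)      <⟨ m-swap-< u v (detPositive 0ℤ (reverse u) v rising falling) ⟩
    m (u ++ b ∷ a ∷ v)      ∎)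
    where
    open ≤-Reasoning
    weaken : ∀ {w′} → ♭ w′ ≡ w′ ⊎ m (♭ w′) < m w′ → m (♭ w′) ≤ m w′
    weaken (inj₁ fixed) = ≤-reflexive (cong m fixed)
    weaken (inj₂ lt)    = <⇒≤ lt

♭-decreases : ∀ w → ♭ w ≡ w ⊎ m (♭ w) < m w
♭-decreases w = go w (<-wellFounded (inversions w))
  where
  go : ∀ w → Acc _<_ (inversions w) → ♭ w ≡ w ⊎ m (♭ w) < m w
  go w (acc smaller) = by-#a (#a w) refl
    where
    by-#a : ∀ d → #a w ≡ d → ♭ w ≡ w ⊎ m (♭ w) < m w
    by-#a zero    d≡ = ♭-decreases-without-a w d≡
    by-#a (suc k) d≡ = ♭-decreases-step w k d≡ λ w′ lt → go w′ (smaller lt)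

lemma3p1 : (w : Word) → (m (♭ w) ≤ m w) × (m (♭ w) ≡ m w → ♭ w ≡ w)
lemma3p1 w with ♭-decreases w
... | inj₁ fixed = ≤-reflexive (cong m fixed) , λ _ → fixed
... | inj₂ lt    = <⇒≤ lt , λ eq → ⊥-elim (<-irrefl eq lt)
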